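{- For every integer $n\ge 1$, $|\mathcal{S}_n(1\text{ - }32,\,3\text{ - }12)| = |\mathcal{S}_n(23\text{ - }1,\,21\text{ - }3)| = 2^{n-1}$.
   Context: A permutation of $[n]=\{1,\dots,n\}$ is written as a word $\pi=a_1a_2\cdots a_n$. For a permutation $xyz$ of $\{1,2,3\}$: $\pi$ contains the pattern $x\text{ - }yz$ if there are indices $1\le i<j<n$ such that $a_i,a_j,a_{j+1}$ are in the same relative order as $x,y,z$; $\pi$ contains the pattern $xy\text{ - }z$ if there are indices $i$ and $k$ with $i+1<k\le n$ such that $a_i,a_{i+1},a_k$ are in the same relative order as $x,y,z$. $\pi$ avoids a pattern if it does not contain it. $\mathcal{S}_n(p,q)$ is the set of permutations of $[n]$ avoiding both $p$ and $q$. -}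

module Defs where

open import Data.Nat using (ℕ; suc; _<_)
open import Data.Fin using (Fin; toℕ)
open import Data.Vec using (Vec; lookup)
open import Data.Product using (_×_; ∃-syntax)
open import Relation.Binary.PropositionalEquality using (_≡_)
open import Relation.Nullary using (¬_)

-- A permutation of [n] as a word a_1 ... a_n; values are Fin n (i.e. 0..n-1,
-- an order-preserving relabelling of 1..n) and positions are Fin n.
IsPermWord : (n : ℕ) → Vec (Fin n) n → Set
IsPermWord n w = ∀ i j → lookup w i ≡ lookup w j → i ≡ j

SameOrder : ℕ → ℕ → ℕ → ℕ → ℕ → ℕ → Set
SameOrder x y z a b c =
  (x < y → a < b) × (y < x → b < a) ×
  (x < z → a < c) × (z < x → c < a) ×
  (y < z → b < c) × (z < y → c < b)

data DashPat : Set where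
  _-_∙_ : ℕ → ℕ → ℕ → DashPat
  _∙_-_ : ℕ → ℕ → ℕ → DashPat

Contains : {n : ℕ} → Vec (Fin n) n → DashPat → Set
Contains {n} w (x - y ∙ z) =
  ∃[ i ] ∃[ j ] ∃[ k ] (toℕ i < toℕ j × toℕ k ≡ suc (toℕ j) ×
    SameOrder x y z (toℕ (lookup w i)) (toℕ (lookup w j)) (toℕ (lookup w k)))
Contains {n} w (x ∙ y - z) =
  ∃[ i ] ∃[ j ] ∃[ k ] (toℕ j ≡ suc (toℕ i) × toℕ j < toℕ k ×
    SameOrder x y z (toℕ (lookup w i)) (toℕ (lookup w j)) (toℕ (lookup w k)))

Avoids : {n : ℕ} → Vec (Fin n) n → DashPat → Set
Avoids w p = ¬ Contains w p

-- S_n(p,q): permutations of [n] avoiding p and q.  Proof fields are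
-- irrelevant, so two elements are equal iff their words are equal.
record S (n : ℕ) (p q : DashPat) : Set where
  constructor mkS
  field
    word : Vec (Fin n) n
    .isPerm : IsPermWord n word
    .avoidsP : Avoids word p
    .avoidsQ : Avoids word q

{-# OPTIONS --safe #-}
module Submission where

-- Avoiding 3-12 means that after an ascent a_j < a_(j+1) the letter a_(j+1) exceeds
-- every earlier letter, and avoiding 1-32 means that after a descent it is below every
-- earlier letter; conversely a word in which every letter after the first is a new
-- maximum or a new minimum avoids both patterns. Two permutations with the same
-- sequence of ascents and descents then have the same relative order everywhere, so
-- they coincide, and every sequence is realised: the letter at position j is the number
-- of later new minima, plus j if position j is a new maximum. Hence S_n(1-32, 3-12) is
-- in bijection with the n-1 bits of the up-down sequence. Reversing a word turns x-yz
-- into its mirror image zy-x, which gives the second count.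

open import Defs
open import Data.Bool using (Bool; true; false; if_then_else_)
open import Data.Empty using (⊥; ⊥-elim)
open import Data.Fin using (Fin; zero; suc; toℕ; fromℕ<; inject₁; opposite; punchOut)
  renaming (_<_ to _<ᶠ_)
import Data.Fin.Properties as Finₚ
open import Data.Fin.Induction using (<-weakInduction; >-weakInduction)
open import Data.Nat using (ℕ; zero; suc; _+_; _∸_; _^_; _≤_; _<_; z≤n; s≤s; s≤s⁻¹; _<?_; _<ᵇ_)
open import Data.Nat.Properties
open import Data.Product using (_×_; _,_; proj₁; proj₂)
open import Data.Sum using (_⊎_; inj₁; inj₂; [_,_]′)
open import Data.Vec using (Vec; []; _∷_; lookup; tabulate)
open import Data.Vec.Properties using (lookup∘tabulate; tabulate-cong; tabulate∘lookup; ≡-dec)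
open import Data.Vec.Relation.Binary.Pointwise.Extensional using (ext; Pointwise-≡⇒≡)
open import Data.Vec.Recursive using (lift↔; Fin[m^n]↔Fin[m]^n)
open import Data.Vec.Recursive.Properties using (↔Vec)
open import Function using (_∘_; id)
open import Function.Bundles using (_↔_; mk↔ₛ′)
open import Function.Definitions using (Injective; StrictlySurjective)
open import Function.Properties.Inverse using (↔-trans; ↔-sym)
open import Relation.Binary using (tri<; tri≈; tri>; _Preserves_⟶_)
open import Relation.Binary.PropositionalEquality
open import Relation.Nullary using (yes; no; recompute; contradiction)
open import Relation.Nullary.Reflects using (ofʸ; ofⁿ)
open import Relation.Nullary.Decidable using (dec-true; dec-false)

private
  variable
    m n : ℕ

Vec-Bool↔Fin-2^ : ∀ m → Vec Bool m ↔ Fin (2 ^ m)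
Vec-Bool↔Fin-2^ m =
  ↔-trans (↔-sym (↔Vec m))
  (↔-trans (lift↔ m (↔-sym Finₚ.2↔Bool)) (↔-sym (Fin[m^n]↔Fin[m]^n 2 m)))

injective⇒strictlySurjective : {f : Fin n → Fin n} → Injective _≡_ _≡_ f → StrictlySurjective _≡_ f
injective⇒strictlySurjective {zero}  _ ()
injective⇒strictlySurjective {suc n} {f} f-inj y with Finₚ.any? (λ x → f x Finₚ.≟ y)
... | yes hit  = hit
... | no  miss = contradiction (Finₚ.injective⇒≤ punchOut∘f-injective) 1+n≰n
  where
  y≢f : ∀ x → y ≢ f x
  y≢f x y≡fx = miss (x , sym y≡fx)

  punchOut∘f-injective : Injective _≡_ _≡_ (λ x → punchOut (y≢f x))
  punchOut∘f-injective {a} {b} = f-inj ∘ Finₚ.punchOut-injective (y≢f a) (y≢f b)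

inject₁<suc : (i : Fin n) → inject₁ i <ᶠ suc i
inject₁<suc i = Finₚ.≤̄⇒inject₁< ≤-refl

inject₁-adjacent : (i : Fin n) → toℕ (suc i) ≡ suc (toℕ (inject₁ i))
inject₁-adjacent i = cong suc (sym (Finₚ.toℕ-inject₁ i))

strictlyMonotone⇒≗id : {f : Fin n → Fin n} → f Preserves _<ᶠ_ ⟶ _<ᶠ_ → ∀ v → f v ≡ v
strictlyMonotone⇒≗id {suc n} {f} mono v = Finₚ.toℕ-injective (≤-antisym (below v) (above v))
  where
  above : ∀ v → toℕ v ≤ toℕ (f v)
  above = <-weakInduction _ z≤n λ i i≤fi →
    ≤-<-trans (≤-trans (≤-reflexive (sym (Finₚ.toℕ-inject₁ i))) i≤fi) (mono (inject₁<suc i))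

  below : ∀ v → toℕ (f v) ≤ toℕ v
  below = >-weakInduction _ (Finₚ.≤fromℕ _) λ i fi≤i →
    ≤-trans (s≤s⁻¹ (<-≤-trans (mono (inject₁<suc i)) fi≤i))
            (≤-reflexive (sym (Finₚ.toℕ-inject₁ i)))

order-preserving⇒≗ : {f g : Fin n → Fin n} → Injective _≡_ _≡_ f →
                     (∀ {i j} → f i <ᶠ f j → g i <ᶠ g j) → ∀ i → f i ≡ g i
order-preserving⇒≗ {f = f} {g} f-inj f<⇒g< i = begin
  f i               ≡⟨ g∘f⁻¹≗id (f i) ⟨
  g (f⁻¹ (f i))     ≡⟨ cong g (f-inj (f∘f⁻¹ (f i))) ⟩
  g i               ∎
  where
  open ≡-Reasoning
  f⁻¹ = λ y → proj₁ (injective⇒strictlySurjective f-inj y)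
  f∘f⁻¹ = λ y → proj₂ (injective⇒strictlySurjective f-inj y)

  g∘f⁻¹≗id : ∀ y → g (f⁻¹ y) ≡ y
  g∘f⁻¹≗id = strictlyMonotone⇒≗id λ {u} {v} u<v →
    f<⇒g< (subst₂ _<ᶠ_ (sym (f∘f⁻¹ u)) (sym (f∘f⁻¹ v)) u<v)

_⟦_⟧ : Vec (Fin n) n → Fin n → ℕ
w ⟦ i ⟧ = toℕ (lookup w i)

SameOrder-132⁺ : ∀ {a b c} → a < c → c < b → SameOrder 1 3 2 a b c
SameOrder-132⁺ a<c c<b =
  (λ _ → <-trans a<c c<b) , (λ { (s≤s ()) }) , (λ _ → a<c) , (λ { (s≤s ()) }) ,
  (λ { (s≤s (s≤s ())) }) , (λ _ → c<b)

SameOrder-312⁺ : ∀ {a b c} → b < c → c < a → SameOrder 3 1 2 a b c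
SameOrder-312⁺ b<c c<a =
  (λ { (s≤s ()) }) , (λ _ → <-trans b<c c<a) , (λ { (s≤s (s≤s ())) }) , (λ _ → c<a) ,
  (λ _ → b<c) , (λ { (s≤s ()) })

SameOrder-132⁻ : ∀ {a b c} → SameOrder 1 3 2 a b c → a < c × c < b
SameOrder-132⁻ (_ , _ , a<c , _ , _ , c<b) = a<c (n<1+n 1) , c<b (n<1+n 2)

SameOrder-312⁻ : ∀ {a b c} → SameOrder 3 1 2 a b c → b < c × c < a
SameOrder-312⁻ (_ , _ , _ , c<a , b<c , _) = b<c (n<1+n 1) , c<a (n<1+n 2)

Ordered : Bool → ℕ → ℕ → Set
Ordered true  a b = a < b
Ordered false a b = b < a

Ordered⇒≢ : ∀ {b x y} → Ordered b x y → x ≢ y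
Ordered⇒≢ {true}  x<y = <⇒≢ x<y
Ordered⇒≢ {false} y<x = >⇒≢ y<x

Ordered-<ᵇ : ∀ {b x y} → Ordered b x y → (x <ᵇ y) ≡ b
Ordered-<ᵇ {true}  {x} {y} x<y = dec-true (x <? y) x<y
Ordered-<ᵇ {false} {x} {y} y<x = dec-false (x <? y) (<-asym y<x)

Ordered-agree : ∀ {b x y x′ y′} → Ordered b x y → Ordered b x′ y′ → x < y → x′ < y′
Ordered-agree {true}  _   x′<y′ _   = x′<y′
Ordered-agree {false} y<x _     x<y = ⊥-elim (<-asym x<y y<x)

Ordered-agree⁻ : ∀ {b x y x′ y′} → Ordered b x y → Ordered b x′ y′ → y < x → y′ < x′
Ordered-agree⁻ {true}  x<y _     y<x = ⊥-elim (<-asym x<y y<x)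
Ordered-agree⁻ {false} _   y′<x′ _   = y′<x′

Ordered-¬between : ∀ {b x y z} → Ordered b x z → Ordered b y z → x < z → z < y → ⊥
Ordered-¬between {true}  _   y<z _   z<y = <-asym y<z z<y
Ordered-¬between {false} z<x _   x<z _   = <-asym x<z z<x

-- B j is true when position j is a left-to-right maximum and false when it is a
-- left-to-right minimum.
record Shaped (B : ℕ → Bool) (w : Vec (Fin n) n) : Set where
  field
    ordered : ∀ {i j} → i <ᶠ j → Ordered (B (toℕ j)) (w ⟦ i ⟧) (w ⟦ j ⟧)

module _ {B : ℕ → Bool} {w : Vec (Fin n) n} (shaped : Shaped B w) where
  open Shaped shaped

  shaped⇒isPermWord : IsPermWord n w
  shaped⇒isPermWord i j eq with Finₚ.<-cmp i j
  ... | tri< i<j _   _   = contradiction (cong toℕ eq) (Ordered⇒≢ (ordered i<j))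
  ... | tri≈ _   i≡j _   = i≡j
  ... | tri> _   _   j<i = contradiction (cong toℕ (sym eq)) (Ordered⇒≢ (ordered j<i))

  shaped⇒avoids-1-32 : Avoids w (1 - 3 ∙ 2)
  shaped⇒avoids-1-32 (i , j , k , i<j , k≡1+j , order) =
    Ordered-¬between (ordered (<-trans i<j j<k)) (ordered j<k) a<c c<b
    where
    j<k = ≤-reflexive (sym k≡1+j)
    a<c = proj₁ (SameOrder-132⁻ order)
    c<b = proj₂ (SameOrder-132⁻ order)

  shaped⇒avoids-3-12 : Avoids w (3 - 1 ∙ 2)
  shaped⇒avoids-3-12 (i , j , k , i<j , k≡1+j , order) =
    Ordered-¬between (ordered j<k) (ordered (<-trans i<j j<k)) b<c c<a
    where
    j<k = ≤-reflexive (sym k≡1+j)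
    b<c = proj₁ (SameOrder-312⁻ order)
    c<a = proj₂ (SameOrder-312⁻ order)

  shaped-unique : {w′ : Vec (Fin n) n} → Shaped B w′ → w ≡ w′
  shaped-unique {w′} shaped′ =
    Pointwise-≡⇒≡ (ext (order-preserving⇒≗ (shaped⇒isPermWord _ _) preserves))
    where
    preserves : ∀ {i j} → w ⟦ i ⟧ < w ⟦ j ⟧ → w′ ⟦ i ⟧ < w′ ⟦ j ⟧
    preserves {i} {j} wi<wj with Finₚ.<-cmp i j
    ... | tri< i<j _    _   = Ordered-agree (ordered i<j) (Shaped.ordered shaped′ i<j) wi<wj
    ... | tri≈ _   refl _   = ⊥-elim (<-irrefl refl wi<wj)
    ... | tri> _   _    j<i = Ordered-agree⁻ (ordered j<i) (Shaped.ordered shaped′ j<i) wi<wj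

-- Bit k of a code describes position k + 1; position 0 has no bit.
shape : Vec Bool m → ℕ → Bool
shape bs       zero          = false
shape []       (suc k)       = false
shape (b ∷ bs) (suc zero)    = b
shape (b ∷ bs) (suc (suc k)) = shape bs (suc k)

shape-suc : (bs : Vec Bool m) (k : Fin m) → shape bs (suc (toℕ k)) ≡ lookup bs k
shape-suc (b ∷ bs) zero    = refl
shape-suc (b ∷ bs) (suc k) = shape-suc bs k

ascents : Vec (Fin (suc m)) (suc m) → Vec Bool m
ascents w = tabulate λ k → w ⟦ inject₁ k ⟧ <ᵇ w ⟦ suc k ⟧

shape-ascents : (w : Vec (Fin (suc m)) (suc m)) (k : Fin m) →
                shape (ascents w) (suc (toℕ k)) ≡ (w ⟦ inject₁ k ⟧ <ᵇ w ⟦ suc k ⟧)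
shape-ascents w k = trans (shape-suc (ascents w) k) (lookup∘tabulate _ k)

isPermWord-cmp : (w : Vec (Fin n) n) → IsPermWord n w → {i j : Fin n} → i ≢ j →
                 w ⟦ i ⟧ < w ⟦ j ⟧ ⊎ w ⟦ j ⟧ < w ⟦ i ⟧
isPermWord-cmp w w-perm {i} {j} i≢j with <-cmp (w ⟦ i ⟧) (w ⟦ j ⟧)
... | tri< wi<wj _    _     = inj₁ wi<wj
... | tri≈ _     wi≡wj _    = contradiction (w-perm i j (Finₚ.toℕ-injective wi≡wj)) i≢j
... | tri> _     _    wj<wi = inj₂ wj<wi

before-suc : (i : Fin (suc m)) (k : Fin m) → i <ᶠ suc k → i ≡ inject₁ k ⊎ i <ᶠ inject₁ k
before-suc i k i<1+k with m≤n⇒m<n∨m≡n (s≤s⁻¹ i<1+k)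
... | inj₁ i<k = inj₂ (subst (toℕ i <_) (sym (Finₚ.toℕ-inject₁ k)) i<k)
... | inj₂ i≡k = inj₁ (Finₚ.toℕ-injective (trans i≡k (sym (Finₚ.toℕ-inject₁ k))))

module _ (w : Vec (Fin (suc m)) (suc m)) (w-perm : IsPermWord (suc m) w)
         (avoids-1-32 : Avoids w (1 - 3 ∙ 2)) (avoids-3-12 : Avoids w (3 - 1 ∙ 2)) where

  ascent⇒maximum : ∀ {i k} → w ⟦ inject₁ k ⟧ < w ⟦ suc k ⟧ →
                   i <ᶠ suc k → w ⟦ i ⟧ < w ⟦ suc k ⟧
  ascent⇒maximum {i} {k} ascent i<j with before-suc i k i<j
  ... | inj₁ refl = ascent
  ... | inj₂ i<k with isPermWord-cmp w w-perm (Finₚ.<⇒≢ i<j)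
  ...   | inj₁ wi<wj = wi<wj
  ...   | inj₂ wj<wi =
    contradiction (i , inject₁ k , suc k , i<k , inject₁-adjacent k , SameOrder-312⁺ ascent wj<wi)
                  avoids-3-12

  descent⇒minimum : ∀ {i k} → w ⟦ suc k ⟧ < w ⟦ inject₁ k ⟧ →
                    i <ᶠ suc k → w ⟦ suc k ⟧ < w ⟦ i ⟧
  descent⇒minimum {i} {k} descent i<j with before-suc i k i<j
  ... | inj₁ refl = descent
  ... | inj₂ i<k with isPermWord-cmp w w-perm (Finₚ.<⇒≢ i<j)
  ...   | inj₂ wj<wi = wj<wi
  ...   | inj₁ wi<wj =
    contradiction (i , inject₁ k , suc k , i<k , inject₁-adjacent k , SameOrder-132⁺ wi<wj descent)
                  avoids-1-32

  new-extremum : ∀ {i} k → i <ᶠ suc k →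
                 Ordered (w ⟦ inject₁ k ⟧ <ᵇ w ⟦ suc k ⟧) (w ⟦ i ⟧) (w ⟦ suc k ⟧)
  new-extremum k i<j
    with w ⟦ inject₁ k ⟧ <ᵇ w ⟦ suc k ⟧ | <ᵇ-reflects-< (w ⟦ inject₁ k ⟧) (w ⟦ suc k ⟧)
  ... | true  | ofʸ ascent  = ascent⇒maximum ascent i<j
  ... | false | ofⁿ ¬ascent = descent⇒minimum descent i<j
    where
    descent : w ⟦ suc k ⟧ < w ⟦ inject₁ k ⟧
    descent = [ (λ ascent → contradiction ascent ¬ascent) , id ]′
                (isPermWord-cmp w w-perm (Finₚ.<⇒≢ (inject₁<suc _)))

  avoids⇒shaped : Shaped (shape (ascents w)) w
  avoids⇒shaped = record { ordered = ordered }
    where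
    ordered : ∀ {i j} → i <ᶠ j → Ordered (shape (ascents w) (toℕ j)) (w ⟦ i ⟧) (w ⟦ j ⟧)
    ordered {i} {suc k} i<j =
      subst (λ b → Ordered b (w ⟦ i ⟧) (w ⟦ suc k ⟧)) (sym (shape-ascents w k))
            (new-extremum k i<j)

∸-split : ∀ {m n o} → m ≤ n → n ≤ o → o ∸ m ≡ (n ∸ m) + (o ∸ n)
∸-split {m} {n} {o} m≤n n≤o = begin
  o ∸ m                ≡⟨ cong (_∸ m) (m∸n+n≡m n≤o) ⟨
  (o ∸ n) + n ∸ m      ≡⟨ +-∸-assoc (o ∸ n) m≤n ⟩
  (o ∸ n) + (n ∸ m)    ≡⟨ +-comm (o ∸ n) (n ∸ m) ⟩
  (n ∸ m) + (o ∸ n)    ∎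
  where open ≡-Reasoning

module _ (B : ℕ → Bool) where

  falseAt : ℕ → ℕ
  falseAt k = if B k then 0 else 1

  countFalse : ℕ → ℕ → ℕ
  countFalse s zero    = 0
  countFalse s (suc l) = falseAt s + countFalse (suc s) l

  countFalse≤ : ∀ s l → countFalse s l ≤ l
  countFalse≤ s zero    = z≤n
  countFalse≤ s (suc l) with B s
  ... | true  = m≤n⇒m≤1+n (countFalse≤ (suc s) l)
  ... | false = s≤s (countFalse≤ (suc s) l)

  countFalse-+ : ∀ s a b → countFalse s (a + b) ≡ countFalse s a + countFalse (a + s) b
  countFalse-+ s zero    b = refl
  countFalse-+ s (suc a) b = begin
    falseAt s + countFalse (suc s) (a + b)
      ≡⟨ cong (falseAt s +_) (countFalse-+ (suc s) a b) ⟩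
    falseAt s + (countFalse (suc s) a + countFalse (a + suc s) b)
      ≡⟨ +-assoc (falseAt s) _ _ ⟨
    falseAt s + countFalse (suc s) a + countFalse (a + suc s) b
      ≡⟨ cong (λ t → falseAt s + countFalse (suc s) a + countFalse t b) (+-suc a s) ⟩
    falseAt s + countFalse (suc s) a + countFalse (suc a + s) b
      ∎
    where open ≡-Reasoning

  laterMinima : ℕ → ℕ → ℕ
  laterMinima n j = countFalse (suc j) (n ∸ suc j)

  rank : ℕ → ℕ → ℕ
  rank n j = if B j then j + laterMinima n j else laterMinima n j

  rank≤ : ∀ n j → rank n j ≤ j + laterMinima n j
  rank≤ n j with B j
  ... | true  = ≤-refl
  ... | false = m≤n+m (laterMinima n j) j

  laterMinima≤rank : ∀ n j → laterMinima n j ≤ rank n j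
  laterMinima≤rank n j with B j
  ... | true  = m≤n+m (laterMinima n j) j
  ... | false = ≤-refl

  rank<n : ∀ {n j} → j < n → rank n j < n
  rank<n {n} {j} j<n = begin-strict
    rank n j                   ≤⟨ rank≤ n j ⟩
    j + laterMinima n j        ≤⟨ +-monoʳ-≤ j (countFalse≤ (suc j) (n ∸ suc j)) ⟩
    j + (n ∸ suc j)            <⟨ n<1+n _ ⟩
    suc j + (n ∸ suc j)        ≡⟨ m+[n∸m]≡n j<n ⟩
    n                          ∎
    where open ≤-Reasoning

  laterMinima-split : ∀ {n i j} → i < j → j < n →
    laterMinima n i ≡ countFalse (suc i) (j ∸ suc i) + (falseAt j + laterMinima n j)
  laterMinima-split {n} {i} {j} i<j j<n = begin
    countFalse (suc i) (n ∸ suc i)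
      ≡⟨ cong (countFalse (suc i)) (∸-split i<j (<⇒≤ j<n)) ⟩
    countFalse (suc i) ((j ∸ suc i) + (n ∸ j))
      ≡⟨ countFalse-+ (suc i) (j ∸ suc i) (n ∸ j) ⟩
    countFalse (suc i) (j ∸ suc i) + countFalse (j ∸ suc i + suc i) (n ∸ j)
      ≡⟨ cong₂ (λ s l → countFalse (suc i) (j ∸ suc i) + countFalse s l)
               (m∸n+n≡m i<j) (+-∸-assoc 1 j<n) ⟩
    countFalse (suc i) (j ∸ suc i) + countFalse j (suc (n ∸ suc j))
      ≡⟨⟩
    countFalse (suc i) (j ∸ suc i) + (falseAt j + laterMinima n j)
      ∎
    where open ≡-Reasoning

  rank-ordered : ∀ {n i j} → i < j → j < n → Ordered (B j) (rank n i) (rank n j)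
  rank-ordered {n} {i} {j} i<j j<n with B j | laterMinima-split i<j j<n
  ... | true  | split = begin-strict
    rank n i                              ≤⟨ rank≤ n i ⟩
    i + laterMinima n i                   ≡⟨ cong (i +_) split ⟩
    i + (between + laterMinima n j)       ≤⟨ +-monoʳ-≤ i (+-monoˡ-≤ _ (countFalse≤ (suc i) (j ∸ suc i))) ⟩
    i + ((j ∸ suc i) + laterMinima n j)   <⟨ n<1+n _ ⟩
    suc i + ((j ∸ suc i) + laterMinima n j) ≡⟨ +-assoc (suc i) _ _ ⟨
    suc i + (j ∸ suc i) + laterMinima n j ≡⟨ cong (_+ laterMinima n j) (m+[n∸m]≡n i<j) ⟩
    j + laterMinima n j                   ∎
    where
    open ≤-Reasoning
    between = countFalse (suc i) (j ∸ suc i)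
  ... | false | split = begin-strict
    laterMinima n j                       <⟨ n<1+n _ ⟩
    suc (laterMinima n j)                 ≤⟨ m≤n+m _ between ⟩
    between + suc (laterMinima n j)       ≡⟨ split ⟨
    laterMinima n i                       ≤⟨ laterMinima≤rank n i ⟩
    rank n i                              ∎
    where
    open ≤-Reasoning
    between = countFalse (suc i) (j ∸ suc i)

decode : (ℕ → Bool) → (n : ℕ) → Vec (Fin n) n
decode B n = tabulate λ j → fromℕ< (rank<n B (Finₚ.toℕ<n j))

decode-value : ∀ B n j → decode B n ⟦ j ⟧ ≡ rank B n (toℕ j)
decode-value B n j = trans (cong toℕ (lookup∘tabulate _ j)) (Finₚ.toℕ-fromℕ< _)

decode-shaped : ∀ B n → Shaped B (decode B n)
decode-shaped B n = record { ordered = λ {i} {j} i<j →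
  subst₂ (Ordered (B (toℕ j))) (sym (decode-value B n i)) (sym (decode-value B n j))
         (rank-ordered B i<j (Finₚ.toℕ<n j)) }

ascents-decode : (bs : Vec Bool m) → ascents (decode (shape bs) (suc m)) ≡ bs
ascents-decode bs = trans (tabulate-cong ascent≡bit) (tabulate∘lookup bs)
  where
  d = decode (shape bs) (suc _)

  ascent≡bit : ∀ k → (d ⟦ inject₁ k ⟧ <ᵇ d ⟦ suc k ⟧) ≡ lookup bs k
  ascent≡bit k = trans (Ordered-<ᵇ (Shaped.ordered (decode-shaped (shape bs) _) (inject₁<suc k)))
                       (shape-suc bs k)

S-≡ : {p q : DashPat} {s t : S n p q} → .(S.word s ≡ S.word t) → s ≡ t
S-≡ {s = mkS w _ _ _} {mkS w′ _ _ _} eq with recompute (≡-dec Finₚ._≟_ w w′) eq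
... | refl = refl

S-↔-ascents : ∀ m → S (suc m) (1 - 3 ∙ 2) (3 - 1 ∙ 2) ↔ Vec Bool m
S-↔-ascents m = mk↔ₛ′ (ascents ∘ S.word) fromAscents ascents-decode decode-ascents
  where
  fromAscents : Vec Bool m → S (suc m) (1 - 3 ∙ 2) (3 - 1 ∙ 2)
  fromAscents bs = mkS (decode (shape bs) (suc m))
    (shaped⇒isPermWord shaped) (shaped⇒avoids-1-32 shaped) (shaped⇒avoids-3-12 shaped)
    where shaped = decode-shaped (shape bs) (suc m)

  decode-ascents : ∀ s → fromAscents (ascents (S.word s)) ≡ s
  decode-ascents (mkS w w-perm avoids-1-32 avoids-3-12) =
    S-≡ (shaped-unique (decode-shaped _ _) (avoids⇒shaped w w-perm avoids-1-32 avoids-3-12))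

SameOrder-reverse : ∀ {x y z a b c} → SameOrder x y z a b c → SameOrder z y x c b a
SameOrder-reverse (x<y , y<x , x<z , z<x , y<z , z<y) = z<y , y<z , z<x , x<z , y<x , x<y

reverse : {A : Set} → Vec A n → Vec A n
reverse w = tabulate (lookup w ∘ opposite)

lookup-reverse : {A : Set} (w : Vec A n) (i : Fin n) → lookup (reverse w) i ≡ lookup w (opposite i)
lookup-reverse w = lookup∘tabulate (lookup w ∘ opposite)

reverse-involutive : {A : Set} (w : Vec A n) → reverse (reverse w) ≡ w
reverse-involutive w = Pointwise-≡⇒≡ (ext λ i → begin
  lookup (reverse (reverse w)) i    ≡⟨ lookup-reverse (reverse w) i ⟩
  lookup (reverse w) (opposite i)   ≡⟨ lookup-reverse w (opposite i) ⟩
  lookup w (opposite (opposite i))  ≡⟨ cong (lookup w) (Finₚ.opposite-involutive i) ⟩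
  lookup w i                        ∎)
  where open ≡-Reasoning

opposite-injective : {i j : Fin n} → opposite i ≡ opposite j → i ≡ j
opposite-injective {i = i} {j} eq =
  trans (sym (Finₚ.opposite-involutive i)) (trans (cong opposite eq) (Finₚ.opposite-involutive j))

reverse-isPermWord : (w : Vec (Fin n) n) → IsPermWord n w → IsPermWord n (reverse w)
reverse-isPermWord w w-perm i j eq =
  opposite-injective (w-perm _ _ (trans (sym (lookup-reverse w i)) (trans eq (lookup-reverse w j))))

opposite-< : {i j : Fin n} → toℕ i < toℕ j → toℕ (opposite j) < toℕ (opposite i)
opposite-< {i = i} {j} i<j
  rewrite Finₚ.opposite-prop i | Finₚ.opposite-prop j = ∸-monoʳ-< (s≤s i<j) (Finₚ.toℕ<n j)

opposite-adjacent : {i j : Fin n} → toℕ j ≡ suc (toℕ i) →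
                    toℕ (opposite i) ≡ suc (toℕ (opposite j))
opposite-adjacent {n} {i} {j} j≡1+i
  rewrite Finₚ.opposite-prop i | Finₚ.opposite-prop j | j≡1+i =
  +-∸-assoc 1 (subst (_< n) j≡1+i (Finₚ.toℕ<n j))

reversePattern : DashPat → DashPat
reversePattern (x - y ∙ z) = z ∙ y - x
reversePattern (x ∙ y - z) = z - y ∙ x

reversePattern-involutive : ∀ p → reversePattern (reversePattern p) ≡ p
reversePattern-involutive (x - y ∙ z) = refl
reversePattern-involutive (x ∙ y - z) = refl

reverse-contains : (w : Vec (Fin n) n) (p : DashPat) →
                   Contains (reverse w) p → Contains w (reversePattern p)
reverse-contains w (x - y ∙ z) (i , j , k , i<j , k≡1+j , order)
  rewrite lookup-reverse w i | lookup-reverse w j | lookup-reverse w k =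
  opposite k , opposite j , opposite i , opposite-adjacent k≡1+j , opposite-< i<j , SameOrder-reverse order
reverse-contains w (x ∙ y - z) (i , j , k , j≡1+i , j<k , order)
  rewrite lookup-reverse w i | lookup-reverse w j | lookup-reverse w k =
  opposite k , opposite j , opposite i , opposite-< j<k , opposite-adjacent j≡1+i , SameOrder-reverse order

reverse-avoids : {w : Vec (Fin n) n} {p : DashPat} → Avoids w (reversePattern p) → Avoids (reverse w) p
reverse-avoids {w = w} {p} avoids = avoids ∘ reverse-contains w p

S-reverse-↔ : {p q : DashPat} → S n (reversePattern p) (reversePattern q) ↔ S n p q
S-reverse-↔ {p = p} {q} =
  mk↔ₛ′ reverseS reverseS⁻¹ (λ _ → S-≡ (reverse-involutive _)) (λ _ → S-≡ (reverse-involutive _))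
  where
  reverseS : S _ (reversePattern p) (reversePattern q) → S _ p q
  reverseS (mkS w w-perm avoids-p avoids-q) =
    mkS (reverse w) (reverse-isPermWord w w-perm) (reverse-avoids avoids-p) (reverse-avoids avoids-q)

  reverseS⁻¹ : S _ p q → S _ (reversePattern p) (reversePattern q)
  reverseS⁻¹ (mkS w w-perm avoids-p avoids-q) =
    mkS (reverse w) (reverse-isPermWord w w-perm)
        (reverse-avoids (subst (Avoids w) (sym (reversePattern-involutive p)) avoids-p))
        (reverse-avoids (subst (Avoids w) (sym (reversePattern-involutive q)) avoids-q))

mainTheorem9 : (n : ℕ) → 1 ≤ n →
    (S n (1 - 3 ∙ 2) (3 - 1 ∙ 2) ↔ Fin (2 ^ (n ∸ 1))) ×
    (S n (2 ∙ 3 - 1) (2 ∙ 1 - 3) ↔ Fin (2 ^ (n ∸ 1)))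
mainTheorem9 (suc m) _ = S-1-32-3-12↔Fin , ↔-trans (↔-sym S-reverse-↔) S-1-32-3-12↔Fin
  where
  S-1-32-3-12↔Fin : S (suc m) (1 - 3 ∙ 2) (3 - 1 ∙ 2) ↔ Fin (2 ^ m)
  S-1-32-3-12↔Fin = ↔-trans (S-↔-ascents m) (Vec-Bool↔Fin-2^ m)
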